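{- A theory $T$ is $n$-ary for some $n$ if and only if $T$ is almost $m$-ary for some $m$.
   Context: For $n\geq 1$, a formula $\varphi(\overline{x})$ of a first-order theory $T$ is called $n$-ary (an $n$-formula) if it is $T$-equivalent to a Boolean combination of $T$-formulas each of which has $n$ free variables. $T$ is unary if every $T$-formula is $T$-equivalent to a Boolean combination of $T$-formulas with one free variable and formulas $x\approx y$; for $n\geq 2$, $T$ is $n$-ary if every $T$-formula is $n$-ary. $T$ is almost $n$-ary if there are finitely many formulas $\varphi_1(\overline{x}),\ldots,\varphi_m(\overline{x})$ such that every $T$-formula is $T$-equivalent to a Boolean combination of $n$-formulas and of formulas obtained from $\varphi_1(\overline{x}),\ldots,\varphi_m(\overline{x})$ by substitutions of free variables. -}

module Defs where

open import Data.Nat using (ℕ; zero; suc; _≥_)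
open import Data.Fin using (Fin)
open import Data.Vec using (Vec; []; _∷_)
open import Data.Vec.Membership.Propositional using (_∈_)
open import Data.Product using (Σ; _×_; ∃; ∃-syntax; _,_)
open import Data.Sum using (_⊎_)
open import Data.Empty using (⊥)
open import Relation.Nullary using (¬_)
open import Relation.Binary.PropositionalEquality using (_≡_)
open import Level using (Lift) renaming (zero to ℓzero; suc to lsuc)

record Signature : Set₁ where
  field
    FunSym  : Set
    funAr   : FunSym → ℕ
    RelSym  : Set
    relAr   : RelSym → ℕ
open Signature public

module _ (L : Signature) where

  data Term : Set where
    var : ℕ → Term
    app : (f : FunSym L) → Vec Term (funAr L f) → Term

  data Formula : Set where
    falsum : Formula
    _≈ₜ_   : Term → Term → Formula
    rel    : (r : RelSym L) → Vec Term (relAr L r) → Formula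
    ¬ₒ_    : Formula → Formula
    _∧ₒ_   : Formula → Formula → Formula
    _∨ₒ_   : Formula → Formula → Formula
    ∀ₒ     : Formula → Formula   -- binds de Bruijn index 0
    ∃ₒ     : Formula → Formula   -- binds de Bruijn index 0

module _ {L : Signature} where

  mutual
    OccT : ℕ → Term L → Set
    OccT k (var i)    = i ≡ k
    OccT k (app f ts) = OccTs k ts

    OccTs : ∀ {n} → ℕ → Vec (Term L) n → Set
    OccTs k []       = ⊥
    OccTs k (t ∷ ts) = OccT k t ⊎ OccTs k ts

  Free : ℕ → Formula L → Set
  Free k falsum    = ⊥
  Free k (t ≈ₜ s)  = OccT k t ⊎ OccT k s
  Free k (rel r ts) = OccTs k ts
  Free k (¬ₒ φ)    = Free k φ
  Free k (φ ∧ₒ ψ)  = Free k φ ⊎ Free k ψ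
  Free k (φ ∨ₒ ψ)  = Free k φ ⊎ Free k ψ
  Free k (∀ₒ φ)    = Free (suc k) φ
  Free k (∃ₒ φ)    = Free (suc k) φ

  Sentence : Formula L → Set
  Sentence φ = ∀ k → ¬ Free k φ

  HasFreeVars : ℕ → Formula L → Set
  HasFreeVars n φ = Σ (Vec ℕ n) λ xs → ∀ k → Free k φ → k ∈ xs

  ext : (ℕ → ℕ) → ℕ → ℕ
  ext σ zero    = zero
  ext σ (suc i) = suc (σ i)

  mutual
    renT : (ℕ → ℕ) → Term L → Term L
    renT σ (var i)    = var (σ i)
    renT σ (app f ts) = app f (renTs σ ts)

    renTs : ∀ {n} → (ℕ → ℕ) → Vec (Term L) n → Vec (Term L) n
    renTs σ []       = []
    renTs σ (t ∷ ts) = renT σ t ∷ renTs σ ts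

  ren : (ℕ → ℕ) → Formula L → Formula L
  ren σ falsum     = falsum
  ren σ (t ≈ₜ s)   = renT σ t ≈ₜ renT σ s
  ren σ (rel r ts) = rel r (renTs σ ts)
  ren σ (¬ₒ φ)     = ¬ₒ ren σ φ
  ren σ (φ ∧ₒ ψ)   = ren σ φ ∧ₒ ren σ ψ
  ren σ (φ ∨ₒ ψ)   = ren σ φ ∨ₒ ren σ ψ
  ren σ (∀ₒ φ)     = ∀ₒ (ren (ext σ) φ)
  ren σ (∃ₒ φ)     = ∃ₒ (ren (ext σ) φ)

  record Structure : Set₁ where
    field
      Carrier : Set
      point   : Carrier              -- structures are nonempty
      funI    : (f : FunSym L) → Vec Carrier (funAr L f) → Carrier
      relI    : (r : RelSym L) → Vec Carrier (relAr L r) → Set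
  open Structure public

  module _ (M : Structure) where
    mutual
      evalT : (ℕ → Carrier M) → Term L → Carrier M
      evalT ρ (var i)    = ρ i
      evalT ρ (app f ts) = funI M f (evalTs ρ ts)

      evalTs : ∀ {n} → (ℕ → Carrier M) → Vec (Term L) n → Vec (Carrier M) n
      evalTs ρ []       = []
      evalTs ρ (t ∷ ts) = evalT ρ t ∷ evalTs ρ ts

    cons : Carrier M → (ℕ → Carrier M) → ℕ → Carrier M
    cons a ρ zero    = a
    cons a ρ (suc i) = ρ i

    -- Gödel–Gentzen style: every clause is ¬¬-stable, so the
    -- semantics validates classical logic.
    Sat : (ℕ → Carrier M) → Formula L → Set
    Sat ρ falsum     = ⊥
    Sat ρ (t ≈ₜ s)   = ¬ ¬ (evalT ρ t ≡ evalT ρ s)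
    Sat ρ (rel r ts) = ¬ ¬ relI M r (evalTs ρ ts)
    Sat ρ (¬ₒ φ)     = ¬ Sat ρ φ
    Sat ρ (φ ∧ₒ ψ)   = Sat ρ φ × Sat ρ ψ
    Sat ρ (φ ∨ₒ ψ)   = ¬ (¬ Sat ρ φ × ¬ Sat ρ ψ)
    Sat ρ (∀ₒ φ)     = (a : Carrier M) → Sat (cons a ρ) φ
    Sat ρ (∃ₒ φ)     = ¬ ((a : Carrier M) → ¬ Sat (cons a ρ) φ)

record Theory (L : Signature) : Set₁ where
  field
    Ax       : Formula L → Set
    axClosed : ∀ φ → Ax φ → Sentence φ
open Theory public

module _ {L : Signature} (T : Theory L) where

  Model : Structure → Set
  Model M = ∀ φ → Ax T φ → ∀ ρ → Sat M ρ φ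

  _≡T_ : Formula L → Formula L → Set₁
  φ ≡T ψ = ∀ (M : Structure) → Model M → ∀ ρ →
             (Sat M ρ φ → Sat M ρ ψ) × (Sat M ρ ψ → Sat M ρ φ)

data BoolComb {L : Signature} (P : Formula L → Set₁) : Formula L → Set₁ where
  base : ∀ {φ} → P φ → BoolComb P φ
  neg  : ∀ {φ} → BoolComb P φ → BoolComb P (¬ₒ φ)
  conj : ∀ {φ ψ} → BoolComb P φ → BoolComb P ψ → BoolComb P (φ ∧ₒ ψ)
  disj : ∀ {φ ψ} → BoolComb P φ → BoolComb P ψ → BoolComb P (φ ∨ₒ ψ)

module _ {L : Signature} (T : Theory L) where

  NFormula : ℕ → Formula L → Set₁
  NFormula n φ = ∃[ ψ ] (BoolComb (λ χ → Lift (lsuc ℓzero) (HasFreeVars n χ)) ψ × (_≡T_ T φ ψ))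

  IsVarEq : Formula L → Set
  IsVarEq φ = ∃[ x ] ∃[ y ] (φ ≡ (var x ≈ₜ var y))

  Unary : Set₁
  Unary = ∀ φ → ∃[ ψ ] (BoolComb (λ χ → Lift (lsuc ℓzero) (HasFreeVars 1 χ ⊎ IsVarEq χ)) ψ × (_≡T_ T φ ψ))

  NAry : ℕ → Set₁
  NAry n = ∀ φ → NFormula n φ

  AlmostNAry : ℕ → Set₁
  AlmostNAry n =
    Σ ℕ λ m → Σ (Fin m → Formula L) λ φs →
      ∀ φ → ∃[ ψ ] (BoolComb (λ χ → NFormula n χ ⊎
                                    Lift (lsuc ℓzero) (∃[ i ] ∃[ σ ] (χ ≡ ren σ (φs i)))) ψ
                    × (_≡T_ T φ ψ))

  -- T is n-ary for some n ≥ 1 (1-ary meaning unary)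
  NAryForSome : Set₁
  NAryForSome = Unary ⊎ (Σ ℕ λ n → (n ≥ 2) × NAry n)

  AlmostNAryForSome : Set₁
  AlmostNAryForSome = Σ ℕ λ m → (m ≥ 1) × AlmostNAry m

-- Every formula has finitely many free variables, and a substitution of variables
-- cannot increase their number. So if T is almost m-ary with exceptional formulas
-- φ₁, …, φₖ, every substitution instance of φᵢ is an N-formula as soon as N bounds
-- the number of free variables of φᵢ; taking also N ≥ 2 and N ≥ m, every formula of T is
-- an N-formula. Conversely an n-ary theory is almost n-ary with no exceptional
-- formula, and a unary theory is almost 1-ary with the single exceptional formula
-- x ≈ y.
module Submission where

open import Defs
open import Data.Empty using (⊥)
open import Data.Fin as Fin using (Fin)
open import Data.Nat using (ℕ; zero; suc; pred; _+_; _≤_; _≥_; _≤′_; ≤′-refl; ≤′-step; _⊔_; s≤s; z≤n)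
open import Data.Nat.Properties using (≤⇒≤′; ≤-trans; suc-injective; m≤m⊔n; m≤n⊔m; m≤n⇒m≤n⊔o)
open import Data.Product as Prod using (Σ; ∃-syntax; _×_; _,_; proj₁; proj₂; map₁; map₂)
open import Data.Sum using (_⊎_; inj₁; inj₂)
open import Data.Vec using (Vec; []; _∷_; _++_; map)
open import Data.Vec.Membership.Propositional using (_∈_)
open import Data.Vec.Membership.Propositional.Properties using (∈-map⁺; ∈-++⁺ˡ; ∈-++⁺ʳ)
open import Data.Vec.Relation.Unary.Any using (here; there)
open import Function using (_∘_)
open import Relation.Binary.PropositionalEquality using (_≡_; refl)
open import Level using (Lift; lift; lower) renaming (zero to ℓzero; suc to lsuc)

Finite : (ℕ → Set) → Set
Finite P = ∃[ n ] Σ (Vec ℕ n) λ xs → ∀ k → P k → k ∈ xs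

Finite-⊥ : Finite (λ _ → ⊥)
Finite-⊥ = 0 , [] , λ _ ()

Finite-≡ : ∀ i → Finite (i ≡_)
Finite-≡ i = 1 , i ∷ [] , λ { _ refl → here refl }

Finite-⊎ : ∀ {P Q} → Finite P → Finite Q → Finite (λ k → P k ⊎ Q k)
Finite-⊎ (m , xs , P⊆xs) (n , ys , Q⊆ys) = m + n , xs ++ ys , λ
  { k (inj₁ p) → ∈-++⁺ˡ (P⊆xs k p)
  ; k (inj₂ q) → ∈-++⁺ʳ xs (Q⊆ys k q)
  }

Finite-∘suc : ∀ {P} → Finite P → Finite (P ∘ suc)
Finite-∘suc (n , xs , P⊆xs) = n , map pred xs , λ k p → ∈-map⁺ pred (P⊆xs (suc k) p)

bounded : ∀ {k} (f : Fin k → ℕ) → ∃[ N ] (∀ i → f i ≤ N)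
bounded {zero}  f = 0 , λ ()
bounded {suc k} f =
  let N , f≤N = bounded (f ∘ Fin.suc) in
  f Fin.zero ⊔ N , λ { Fin.zero → m≤m⊔n _ _ ; (Fin.suc i) → ≤-trans (f≤N i) (m≤n⊔m _ _) }

boolComb-map : ∀ {L} {P Q : Formula L → Set₁} → (∀ {χ} → P χ → Q χ) →
               ∀ {φ} → BoolComb P φ → BoolComb Q φ
boolComb-map f (base p)   = base (f p)
boolComb-map f (neg b)    = neg (boolComb-map f b)
boolComb-map f (conj a b) = conj (boolComb-map f a) (boolComb-map f b)
boolComb-map f (disj a b) = disj (boolComb-map f a) (boolComb-map f b)

module _ {L : Signature} where

  mutual
    occT-finite : (t : Term L) → Finite (λ k → OccT k t)
    occT-finite (var i)    = Finite-≡ i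
    occT-finite (app f ts) = occTs-finite ts

    occTs-finite : ∀ {n} (ts : Vec (Term L) n) → Finite (λ k → OccTs k ts)
    occTs-finite []       = Finite-⊥
    occTs-finite (t ∷ ts) = Finite-⊎ (occT-finite t) (occTs-finite ts)

  free-finite : (φ : Formula L) → ∃[ n ] HasFreeVars n φ
  free-finite falsum     = Finite-⊥
  free-finite (t ≈ₜ s)   = Finite-⊎ (occT-finite t) (occT-finite s)
  free-finite (rel r ts) = occTs-finite ts
  free-finite (¬ₒ φ)     = free-finite φ
  free-finite (φ ∧ₒ ψ)   = Finite-⊎ (free-finite φ) (free-finite ψ)
  free-finite (φ ∨ₒ ψ)   = Finite-⊎ (free-finite φ) (free-finite ψ)
  free-finite (∀ₒ φ)     = Finite-∘suc (free-finite φ)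
  free-finite (∃ₒ φ)     = Finite-∘suc (free-finite φ)

  mutual
    occT-ren : ∀ {k} σ t → OccT k (renT σ t) → ∃[ j ] (OccT j t × σ j ≡ k)
    occT-ren σ (var i)    σi≡k = i , refl , σi≡k
    occT-ren σ (app f ts) o    = occTs-ren σ ts o

    occTs-ren : ∀ {k n} σ (ts : Vec (Term L) n) → OccTs k (renTs σ ts) → ∃[ j ] (OccTs j ts × σ j ≡ k)
    occTs-ren σ (t ∷ ts) (inj₁ o) = map₂ (map₁ inj₁) (occT-ren σ t o)
    occTs-ren σ (t ∷ ts) (inj₂ o) = map₂ (map₁ inj₂) (occTs-ren σ ts o)

  ext-preimage : ∀ {σ k} (φ : Formula L) → ∃[ j ] (Free j φ × ext {L} σ j ≡ suc k) → ∃[ j ] (Free (suc j) φ × σ j ≡ k)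
  ext-preimage φ (zero  , _ , ())
  ext-preimage φ (suc j , p , eq) = j , p , suc-injective eq

  free-ren : ∀ {k} σ φ → Free k (ren σ φ) → ∃[ j ] (Free j φ × σ j ≡ k)
  free-ren σ (t ≈ₜ s)   (inj₁ o) = map₂ (map₁ inj₁) (occT-ren σ t o)
  free-ren σ (t ≈ₜ s)   (inj₂ o) = map₂ (map₁ inj₂) (occT-ren σ s o)
  free-ren σ (rel r ts) o        = occTs-ren σ ts o
  free-ren σ (¬ₒ φ)     o        = free-ren σ φ o
  free-ren σ (φ ∧ₒ ψ)   (inj₁ o) = map₂ (map₁ inj₁) (free-ren σ φ o)
  free-ren σ (φ ∧ₒ ψ)   (inj₂ o) = map₂ (map₁ inj₂) (free-ren σ ψ o)
  free-ren σ (φ ∨ₒ ψ)   (inj₁ o) = map₂ (map₁ inj₁) (free-ren σ φ o)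
  free-ren σ (φ ∨ₒ ψ)   (inj₂ o) = map₂ (map₁ inj₂) (free-ren σ ψ o)
  free-ren σ (∀ₒ φ)     o        = ext-preimage φ (free-ren (ext {L} σ) φ o)
  free-ren σ (∃ₒ φ)     o        = ext-preimage φ (free-ren (ext {L} σ) φ o)

  hasFreeVars-ren : ∀ {n} σ φ → HasFreeVars n φ → HasFreeVars n (ren σ φ)
  hasFreeVars-ren σ φ (xs , free⊆xs) = map σ xs , λ k → image ∘ free-ren σ φ
    where
    image : ∀ {k} → ∃[ j ] (Free j φ × σ j ≡ k) → k ∈ map σ xs
    image (j , free , refl) = ∈-map⁺ σ (free⊆xs j free)

  hasFreeVars-mono : ∀ {m n} (φ : Formula L) → m ≤ n → HasFreeVars m φ → HasFreeVars n φ
  hasFreeVars-mono φ = go ∘ ≤⇒≤′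
    where
    go : ∀ {m n} → m ≤′ n → HasFreeVars m φ → HasFreeVars n φ
    go ≤′-refl        h = h
    go (≤′-step m≤′n) h = let xs , free⊆xs = go m≤′n h in 0 ∷ xs , λ k → there ∘ free⊆xs k

module _ {L : Signature} (T : Theory L) where

  ≡T-refl : ∀ {φ} → _≡T_ T φ φ
  ≡T-refl M _ ρ = (λ s → s) , (λ s → s)

  ≡T-trans : ∀ {φ ψ χ} → _≡T_ T φ ψ → _≡T_ T ψ χ → _≡T_ T φ χ
  ≡T-trans φ≡ψ ψ≡χ M m ρ =
    let to₁ , from₁ = φ≡ψ M m ρ ; to₂ , from₂ = ψ≡χ M m ρ in to₂ ∘ to₁ , from₁ ∘ from₂

  ¬ₒ-cong : ∀ {φ φ'} → _≡T_ T φ φ' → _≡T_ T (¬ₒ φ) (¬ₒ φ')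
  ¬ₒ-cong φ≡φ' M m ρ = let to , from = φ≡φ' M m ρ in (_∘ from) , (_∘ to)

  ∧ₒ-cong : ∀ {φ φ' ψ ψ'} → _≡T_ T φ φ' → _≡T_ T ψ ψ' → _≡T_ T (φ ∧ₒ ψ) (φ' ∧ₒ ψ')
  ∧ₒ-cong φ≡φ' ψ≡ψ' M m ρ =
    let to₁ , from₁ = φ≡φ' M m ρ ; to₂ , from₂ = ψ≡ψ' M m ρ in
    Prod.map to₁ to₂ , Prod.map from₁ from₂

  ∨ₒ-cong : ∀ {φ φ' ψ ψ'} → _≡T_ T φ φ' → _≡T_ T ψ ψ' → _≡T_ T (φ ∨ₒ ψ) (φ' ∨ₒ ψ')
  ∨ₒ-cong φ≡φ' ψ≡ψ' M m ρ =
    let to₁ , from₁ = φ≡φ' M m ρ ; to₂ , from₂ = ψ≡ψ' M m ρ in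
    (_∘ Prod.map (_∘ to₁) (_∘ to₂)) , (_∘ Prod.map (_∘ from₁) (_∘ from₂))

  nFormula-boolComb : ∀ {n φ} → BoolComb (NFormula T n) φ → NFormula T n φ
  nFormula-boolComb (base p) = p
  nFormula-boolComb (neg b) =
    let ψ , c , e = nFormula-boolComb b in ¬ₒ ψ , neg c , ¬ₒ-cong e
  nFormula-boolComb (conj a b) =
    let ψ , c , e = nFormula-boolComb a ; ψ' , c' , e' = nFormula-boolComb b in
    ψ ∧ₒ ψ' , conj c c' , ∧ₒ-cong e e'
  nFormula-boolComb (disj a b) =
    let ψ , c , e = nFormula-boolComb a ; ψ' , c' , e' = nFormula-boolComb b in
    ψ ∨ₒ ψ' , disj c c' , ∨ₒ-cong e e'

  nFormula-mono : ∀ {m n φ} → m ≤ n → NFormula T m φ → NFormula T n φ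
  nFormula-mono m≤n (ψ , c , e) = ψ , boolComb-map (λ {χ} → lift ∘ hasFreeVars-mono χ m≤n ∘ lower) c , e

  nFormula-ren : ∀ {n} σ φ → HasFreeVars n φ → NFormula T n (ren σ φ)
  nFormula-ren σ φ h = ren σ φ , base (lift (hasFreeVars-ren σ φ h)) , ≡T-refl

  unary⇒almostNAry : Unary T → AlmostNAry T 1
  unary⇒almostNAry unary = 1 , (λ _ → var 0 ≈ₜ var 1) , λ φ →
    let ψ , c , e = unary φ in ψ , boolComb-map classify c , e
    where
    classify : ∀ {χ} → Lift (lsuc ℓzero) (HasFreeVars 1 χ ⊎ IsVarEq T χ) →
               NFormula T 1 χ ⊎ Lift (lsuc ℓzero) (∃[ i ] ∃[ σ ] (χ ≡ ren σ (var 0 ≈ₜ var 1)))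
    classify (lift (inj₁ h)) = inj₁ (_ , base (lift h) , ≡T-refl)
    classify (lift (inj₂ (x , y , refl))) = inj₂ (lift (Fin.zero , (λ { zero → x ; (suc _) → y }) , refl))

  nAry⇒almostNAry : ∀ {n} → NAry T n → AlmostNAry T n
  nAry⇒almostNAry nAry = 0 , (λ ()) , λ φ → φ , base (inj₁ (nAry φ)) , ≡T-refl

  almostNAry⇒nAry : ∀ {m} → AlmostNAry T m → ∃[ N ] (N ≥ 2 × NAry T N)
  almostNAry⇒nAry {m} (k , φs , decompose) = N , 2≤N , λ φ →
    let ψ , c , φ≡ψ = decompose φ ; ψ' , c' , ψ≡ψ' = nFormula-boolComb (boolComb-map toN c) in
    ψ' , c' , ≡T-trans φ≡ψ ψ≡ψ'
    where
    width : Fin k → ℕ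
    width = proj₁ ∘ free-finite ∘ φs
    B : ℕ
    B = proj₁ (bounded width)
    N : ℕ
    N = 2 ⊔ m ⊔ B
    2≤N : 2 ≤ N
    2≤N = m≤n⇒m≤n⊔o B (m≤m⊔n 2 m)
    toN : ∀ {χ} → NFormula T m χ ⊎ Lift (lsuc ℓzero) (∃[ i ] ∃[ σ ] (χ ≡ ren σ (φs i))) → NFormula T N χ
    toN (inj₁ nf) = nFormula-mono (m≤n⇒m≤n⊔o B (m≤n⊔m 2 m)) nf
    toN (inj₂ (lift (i , σ , refl))) =
      let width≤N = ≤-trans (proj₂ (bounded width) i) (m≤n⊔m (2 ⊔ m) B) in
      nFormula-ren σ (φs i) (hasFreeVars-mono (φs i) width≤N (proj₂ (free-finite (φs i))))

corollary2p4 : {L : Signature} (T : Theory L) →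
    (NAryForSome T → AlmostNAryForSome T) × (AlmostNAryForSome T → NAryForSome T)
corollary2p4 T = fromNAry , fromAlmostNAry
  where
  fromNAry : NAryForSome T → AlmostNAryForSome T
  fromNAry (inj₁ unary)             = 1 , s≤s z≤n , unary⇒almostNAry T unary
  fromNAry (inj₂ (n , 2≤n , nAry)) = n , ≤-trans (s≤s z≤n) 2≤n , nAry⇒almostNAry T nAry
  fromAlmostNAry : AlmostNAryForSome T → NAryForSome T
  fromAlmostNAry (_ , _ , almostNAry) = inj₂ (almostNAry⇒nAry T almostNAry)
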